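{- For every integer $n \geq 4$, $g(n) \leq 2n$.
   Context: For a non-negative integer $n$, $g(n)$ is the least integer $k$ such that there exists a strictly increasing sequence of integers $n = a_1 < a_2 < \cdots < a_t = k$ ($t \geq 1$) whose product $a_1 a_2 \cdots a_t$ is a perfect square. -}

module Defs where

open import Data.Nat using (ℕ; _*_; _<_; _≤_)
open import Data.List using (List; []; _∷_)
open import Data.Nat.ListAction using (product)
open import Relation.Binary.PropositionalEquality using (_≡_)
open import Data.Product using (∃; _×_)

IsSquare : ℕ → Set
IsSquare m = ∃ λ r → r * r ≡ m

-- StrictChain a k xs : the list  a ∷ xs  is strictly increasing and its last
-- element is k  (so  a = a₁ < a₂ < ⋯ < a_t = k, with xs = [a₂, …, a_t]).
data StrictChain : ℕ → ℕ → List ℕ → Set where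
  done : ∀ {a} → StrictChain a a []
  step : ∀ {a b k xs} → a < b → StrictChain b k xs → StrictChain a k (b ∷ xs)

Admissible : ℕ → ℕ → Set
Admissible n k = ∃ λ xs → StrictChain n k xs × IsSquare (product (n ∷ xs))

IsG : ℕ → ℕ → Set
IsG n k = Admissible n k × (∀ j → Admissible n j → k ≤ j)

-- For n ≥ 10 pick m with n < 8m < 9m < 2n (m = ⌊n/8⌋ + 1 works); then
-- n · 8m · 9m · 2n = (12nm)², so g(n) ≤ 2n.  For 4 ≤ n ≤ 9 explicit sequences
-- do the job: 4, 5·8·10, 6·8·12, 7·8·14, 8·10·12·15 and 9.  Since admissibility
-- is decidable (a chain from n to k has terms in [n, k]), every admissible k
-- bounds the least one, which is g(n).
module Submission where

open import Data.Nat using (ℕ; zero; suc; _+_; _*_; _<_; _≤_; z≤n; s≤s; _≟_; _<?_; _≤?_)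
open import Data.Nat.Properties
open import Data.Nat.DivMod using (_/_; _%_; m≡m%n+[m/n]*n; m%n<n)
open import Data.Nat.Induction using (<-rec)
open import Data.Nat.ListAction using (product)
open import Data.Nat.Tactic.RingSolver using (solve-∀)
open import Data.List using ([]; _∷_)
open import Data.Product using (∃; _×_; _,_)
open import Data.Sum using (_⊎_; inj₁; inj₂)
open import Function.Bundles using (_⇔_; mk⇔)
open import Relation.Nullary using (Dec; yes; no; contradiction)
open import Relation.Nullary.Decidable using (map; map′; from-yes; _×-dec_; _⊎-dec_)
open import Relation.Unary using (Pred; Decidable)
open import Relation.Binary.PropositionalEquality using (_≡_; refl; sym; trans; subst)

open import Defs

Least : ∀ {p} → Pred ℕ p → ℕ → Set p
Least P k = P k × (∀ j → P j → k ≤ j)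

least-below : ∀ {p} {P : Pred ℕ p} → Decidable P → ∀ K → P K → ∃ λ k → Least P k × k ≤ K
least-below {P = P} P? = <-rec (λ K → P K → ∃ λ k → Least P k × k ≤ K) go
  where
  go : ∀ K → (∀ {j} → j < K → P j → ∃ λ k → Least P k × k ≤ j) → P K → ∃ λ k → Least P k × k ≤ K
  go K below PK with anyUpTo? P? K
  ... | yes (j , j<K , Pj) = let (k , least , k≤j) = below j<K Pj in k , least , ≤-trans k≤j (<⇒≤ j<K)
  ... | no none = K , (PK , λ j Pj → ≮⇒≥ (λ j<K → none (j , j<K , Pj))) , ≤-refl

root<1+square : ∀ r {m} → r * r ≡ m → r < suc m
root<1+square zero    _    = s≤s z≤n
root<1+square (suc r) refl = s≤s (m≤m*n (suc r) (suc r))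

isSquare? : ∀ m → Dec (IsSquare m)
isSquare? m = map′ (λ (r , _ , e) → r , e) (λ (r , e) → r , root<1+square r e , e)
                   (anyUpTo? (λ r → r * r ≟ m) (suc m))

StrictChain⇒≤ : ∀ {a k xs} → StrictChain a k xs → a ≤ k
StrictChain⇒≤ done          = ≤-refl
StrictChain⇒≤ (step a<b ch) = ≤-trans (<⇒≤ a<b) (StrictChain⇒≤ ch)

-- c is the product of the terms of the sequence chosen before a.
SquareChain : ℕ → ℕ → ℕ → Set
SquareChain c a k = ∃ λ xs → StrictChain a k xs × IsSquare (c * product (a ∷ xs))

SquareChainCases : ℕ → ℕ → ℕ → Set
SquareChainCases c a k =
  (a ≡ k × IsSquare (c * (a * 1))) ⊎ (∃ λ b → b < suc k × a < b × SquareChain (c * a) b k)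

SquareChain-cases : ∀ {c a k} → SquareChainCases c a k ⇔ SquareChain c a k
SquareChain-cases {c} {a} {k} = mk⇔ to from
  where
  to : SquareChainCases c a k → SquareChain c a k
  to (inj₁ (refl , s))                      = [] , done , s
  to (inj₂ (b , _ , a<b , ys , ch , r , e)) = b ∷ ys , step a<b ch , r , trans e (*-assoc c a _)

  from : SquareChain c a k → SquareChainCases c a k
  from ([] , done , s)                  = inj₁ (refl , s)
  from (b ∷ ys , step a<b ch , r , e) =
    inj₂ (b , s≤s (StrictChain⇒≤ ch) , a<b , ys , ch , r , trans e (sym (*-assoc c a _)))

squareChain? : ∀ fuel c a k → k < fuel + a → Dec (SquareChain c a k)
squareChain? zero c a k k<a = no λ (_ , ch , _) → <⇒≱ k<a (StrictChain⇒≤ ch)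
squareChain? (suc fuel) c a k k<1+fuel+a =
  map (SquareChain-cases {c}) ((a ≟ k ×-dec isSquare? _) ⊎-dec anyUpTo? next? (suc k))
  where
  next? : Decidable (λ b → a < b × SquareChain (c * a) b k)
  next? b with a <? b
  ... | no a≮b  = no λ (a<b , _) → a≮b a<b
  ... | yes a<b = map′ (a<b ,_) (λ (_ , q) → q) (squareChain? fuel (c * a) b k k<fuel+b)
    where
    k<fuel+b : k < fuel + b
    k<fuel+b = ≤-trans k<1+fuel+a (≤-trans (≤-reflexive (sym (+-suc fuel a))) (+-monoʳ-≤ fuel a<b))

admissible? : ∀ n k → Dec (Admissible n k)
admissible? n k =
  map′ (λ (xs , ch , r , e) → xs , ch , r , trans e (*-identityˡ _))
       (λ (xs , ch , r , e) → xs , ch , r , trans e (sym (*-identityˡ _)))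
       (squareChain? (suc k) 1 n k (s≤s (m≤m+n k n)))

Window : ℕ → ℕ → Set
Window n m = n < 8 * m × 9 * m < 2 * n

window⇒admissible : ∀ {n} m → Window n m → Admissible n (2 * n)
window⇒admissible {n} (suc m) (n<8m , 9m<2n) =
  8 * suc m ∷ 9 * suc m ∷ 2 * n ∷ [] ,
  step n<8m (step (*-monoˡ-< (suc m) (from-yes (8 <? 9))) (step 9m<2n done)) ,
  12 * n * suc m , product≡square n (suc m)
  where
  product≡square : ∀ n m → (12 * n * m) * (12 * n * m) ≡ n * (8 * m * (9 * m * (2 * n * 1)))
  product≡square = solve-∀

window-by-division : ∀ r q → r < 8 → 10 ≤ r + q * 8 → Window (r + q * 8) (suc q)
window-by-division r q r<8 10≤n = n<8[1+q] , 9[1+q]<2n r q r<8 10≤n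
  where
  n<8[1+q] : r + q * 8 < 8 * suc q
  n<8[1+q] = <-≤-trans (+-monoˡ-< (q * 8) r<8) (≤-reflexive (8+q*8≡8[1+q] q))
    where
    8+q*8≡8[1+q] : ∀ q → 8 + q * 8 ≡ 8 * suc q
    8+q*8≡8[1+q] = solve-∀

  9[1+q]<2n : ∀ r q → r < 8 → 10 ≤ r + q * 8 → 9 * suc q < 2 * (r + q * 8)
  9[1+q]<2n r zero r<8 10≤r+0 =
    contradiction (subst (10 ≤_) (+-identityʳ r) 10≤r+0) (<⇒≱ (<-≤-trans r<8 (m≤n+m 8 2)))
  9[1+q]<2n r (suc zero) _ 10≤r+8 = <-≤-trans (from-yes (18 <? 20)) (*-monoʳ-≤ 2 (+-monoˡ-≤ 8 2≤r))
    where
    2≤r : 2 ≤ r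
    2≤r = +-cancelʳ-≤ 8 2 r 10≤r+8
  9[1+q]<2n r (suc (suc q)) _ _ = subst (9 * (3 + q) <_) (sym (2n≡ r q)) (m<m+n (9 * (3 + q)) (s≤s z≤n))
    where
    2n≡ : ∀ r q → 2 * (r + (2 + q) * 8) ≡ 9 * (3 + q) + (5 + 2 * r + 7 * q)
    2n≡ = solve-∀

window : ∀ n → 10 ≤ n → ∃ (Window n)
window n 10≤n = suc (n / 8) ,
  subst (λ x → Window x (suc (n / 8))) (sym n≡r+q*8)
    (window-by-division (n % 8) (n / 8) (m%n<n n 8) (subst (10 ≤_) n≡r+q*8 10≤n))
  where
  n≡r+q*8 : n ≡ n % 8 + n / 8 * 8
  n≡r+q*8 = m≡m%n+[m/n]*n n 8

admissible-below-double : ∀ n → 4 ≤ n → ∃ λ K → Admissible n K × K ≤ 2 * n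
admissible-below-double 4 _ = 4  , ([] , done , 2 , refl) , from-yes (4 ≤? 8)
admissible-below-double 5 _ = 10 , (8 ∷ 10 ∷ [] , step (from-yes (5 <? 8)) (step (from-yes (8 <? 10)) done) , 20 , refl) , ≤-refl
admissible-below-double 6 _ = 12 , (8 ∷ 12 ∷ [] , step (from-yes (6 <? 8)) (step (from-yes (8 <? 12)) done) , 24 , refl) , ≤-refl
admissible-below-double 7 _ = 14 , (8 ∷ 14 ∷ [] , step (from-yes (7 <? 8)) (step (from-yes (8 <? 14)) done) , 28 , refl) , ≤-refl
admissible-below-double 8 _ = 15 ,
  (10 ∷ 12 ∷ 15 ∷ [] , step (from-yes (8 <? 10)) (step (from-yes (10 <? 12)) (step (from-yes (12 <? 15)) done)) , 120 , refl) ,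
  from-yes (15 ≤? 16)
admissible-below-double 9 _ = 9  , ([] , done , 3 , refl) , from-yes (9 ≤? 18)
admissible-below-double n@(suc (suc (suc (suc (suc (suc (suc (suc (suc (suc k)))))))))) _ =
  let (m , w) = window n (m≤m+n 10 k) in 2 * n , window⇒admissible m w , ≤-refl
admissible-below-double 0 ()
admissible-below-double 1 (s≤s ())
admissible-below-double 2 (s≤s (s≤s ()))
admissible-below-double 3 (s≤s (s≤s (s≤s ())))

lemma1p6 : ∀ (n : ℕ) → 4 ≤ n → ∃ λ k → IsG n k × k ≤ 2 * n
lemma1p6 n 4≤n =
  let (K , admissible , K≤2n) = admissible-below-double n 4≤n
      (k , least , k≤K)       = least-below (admissible? n) K admissible
  in k , least , ≤-trans k≤K K≤2n
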